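{- Let $L=\{(p_1,q_1),\dots,(p_n,q_n)\}$ be a set of $n$ distinct lattice cells, listed in increasing lexicographic order. Then for all integers $h,k\ge 0$ with $h+k\ge 1$, $$\sum_{s=1}^n \partial_{x_s}^h\partial_{y_s}^k\,\Delta_L(x;y)=\sum_{s=1}^n \epsilon(L\!\downarrow^s_{hk})\,\Delta_{L\downarrow^s_{hk}}(x;y),$$ where $L\!\downarrow^s_{hk}$ is the list $(p_1,q_1),\dots,(p_s-h,q_s-k),\dots,(p_n,q_n)$ (the $s$-th cell replaced by $(p_s-h,q_s-k)$), and the coefficient $\epsilon(L\!\downarrow^s_{hk})$ is $0$ unless $p_s-h\ge0$, $q_s-k\ge 0$ and the $n$ cells of $L\!\downarrow^s_{hk}$ are distinct, in which case it equals the sign of the permutation that rearranges the list $L\!\downarrow^s_{hk}$ into increasing lexicographic order (and $\Delta_{L\downarrow^s_{hk}}$ denotes the lattice determinant of the set of these cells, listed in lexicographic order).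
   Context: Lattice cells are pairs $(i,j)$ of nonnegative integers. For a set $L$ of $n$ distinct cells listed in increasing lexicographic order as $(p_1,q_1),\dots,(p_n,q_n)$, the lattice determinant is $\Delta_L(x;y)=\frac{1}{p!\,q!}\det\|x_i^{p_j}y_i^{q_j}\|_{i,j=1}^n$, where $p!=p_1!\cdots p_n!$ and $q!=q_1!\cdots q_n!$; it is a polynomial in $x_1,\dots,x_n,y_1,\dots,y_n$ with rational coefficients. -}

module Defs where

open import Data.Nat as ℕ using (ℕ; zero; suc; _∸_; _!; _≤ᵇ_)
open import Data.Nat.Properties using (_!≢0)
import Data.Nat.Properties as ℕP
open import Data.Integer using (+_)
open import Data.Rational using (ℚ; 0ℚ; 1ℚ; _+_; _*_; -_; _/_)
open import Data.Fin using (Fin; zero; suc; toℕ; punchIn)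
open import Data.Product using (_×_; _,_; proj₁; proj₂)
open import Data.Sum using (_⊎_)
open import Data.Bool using (Bool; true; false; _∧_; if_then_else_)
open import Data.List using (List; []; _∷_; _++_; map; concatMap)
open import Data.Vec using (Vec; []; _∷_; lookup; replicate; zipWith; count; _[_]≔_)
import Data.Vec.Properties as VecP
import Data.Product.Properties as ProdP
open import Relation.Nullary using (Dec; yes; no; does; _×-dec_; _⊎-dec_)
open import Relation.Binary.PropositionalEquality using (_≡_)

-- A polynomial is a finite formal sum of terms c · x^a · y^b
-- (a, b ∈ ℕ^m exponent vectors); two polynomials are equal when all
-- their coefficients agree.

Exps : ℕ → Set
Exps m = Vec ℕ m

Term : ℕ → Set
Term m = ℚ × (Exps m × Exps m)

Poly : ℕ → Set
Poly m = List (Term m)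

coeff : ∀ {m} → Poly m → Exps m → Exps m → ℚ
coeff [] a b = 0ℚ
coeff ((c , a′ , b′) ∷ P) a b with VecP.≡-dec ℕP._≟_ a′ a ×-dec VecP.≡-dec ℕP._≟_ b′ b
... | yes _ = c + coeff P a b
... | no  _ = coeff P a b

infix 4 _≈P_
_≈P_ : ∀ {m} → Poly m → Poly m → Set
P ≈P Q = ∀ a b → coeff P a b ≡ coeff Q a b

constP : ∀ {m} → ℚ → Poly m
constP {m} c = (c , replicate m 0 , replicate m 0) ∷ []

infixl 6 _+P_
_+P_ : ∀ {m} → Poly m → Poly m → Poly m
_+P_ = _++_

infixl 7 _*P_
_*P_ : ∀ {m} → Poly m → Poly m → Poly m
P *P Q = concatMap (λ { (c , a , b) →
           map (λ { (d , a′ , b′) → (c * d , zipWith ℕ._+_ a a′ , zipWith ℕ._+_ b b′) }) Q }) P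

scaleP : ∀ {m} → ℚ → Poly m → Poly m
scaleP c = map (λ { (d , a , b) → (c * d , a , b) })

sumP : ∀ {m n} → (Fin n → Poly m) → Poly m
sumP {n = zero}  f = []
sumP {n = suc n} f = f zero +P sumP (λ s → f (suc s))

ff : ℕ → ℕ → ℕ
ff a zero = 1
ff zero (suc h) = 0
ff (suc a) (suc h) = suc a ℕ.* ff a h

∂ : ∀ {m} → Fin m → ℕ → ℕ → Poly m → Poly m
∂ s h k = map (λ { (c , a , b) →
  (c * ((+ ff (lookup a s) h / 1) * (+ ff (lookup b s) k / 1))
  , a [ s ]≔ (lookup a s ∸ h) , b [ s ]≔ (lookup b s ∸ k)) })

sgn : ℕ → ℚ
sgn zero = 1ℚ
sgn (suc j) = - sgn j

det : ∀ {m k} → (Fin k → Fin k → Poly m) → Poly m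
det {k = zero}  M = constP 1ℚ
det {k = suc k} M =
  sumP (λ j → scaleP (sgn (toℕ j)) (M zero j *P det (λ i j′ → M (suc i) (punchIn j j′))))

Cell : Set
Cell = ℕ × ℕ

infix 4 _<lex_
_<lex_ : Cell → Cell → Set
(p , q) <lex (p′ , q′) = p ℕ.< p′ ⊎ (p ≡ p′ × q ℕ.< q′)

_<lex?_ : (c d : Cell) → Dec (c <lex d)
(p , q) <lex? (p′ , q′) = (p ℕ.<? p′) ⊎-dec ((p ℕP.≟ p′) ×-dec (q ℕ.<? q′))

_≟C_ : (c d : Cell) → Dec (c ≡ d)
_≟C_ = ProdP.≡-dec ℕP._≟_ ℕP._≟_

LexIncreasing : ∀ {n} → Vec Cell n → Set
LexIncreasing {n} L = ∀ (i j : Fin n) → i Data.Fin.< j → lookup L i <lex lookup L j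

insertLex : ∀ {n} → Cell → Vec Cell n → Vec Cell (suc n)
insertLex c [] = c ∷ []
insertLex c (d ∷ ds) with does (d <lex? c)
... | true  = d ∷ insertLex c ds
... | false = c ∷ d ∷ ds

sortLex : ∀ {n} → Vec Cell n → Vec Cell n
sortLex [] = []
sortLex (c ∷ cs) = insertLex c (sortLex cs)

distinct : ∀ {n} → Vec Cell n → Bool
distinct [] = true
distinct (c ∷ cs) = (count (c ≟C_) cs ℕ.≡ᵇ 0) ∧ distinct cs

inversions : ∀ {n} → Vec Cell n → ℕ
inversions [] = 0
inversions (c ∷ cs) = count (_<lex? c) cs ℕ.+ inversions cs

-- sign of the permutation rearranging a list of distinct cells into
-- increasing lexicographic order = (-1)^(number of inversions)
sortSign : ∀ {n} → Vec Cell n → ℚ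
sortSign L = sgn (inversions L)

monomial : ∀ {m} → Fin m → ℕ → ℕ → Poly m
monomial {m} i p q = (1ℚ , replicate m 0 [ i ]≔ p , replicate m 0 [ i ]≔ q) ∷ []

invFact : ∀ {n} → Vec Cell n → ℚ
invFact [] = 1ℚ
invFact ((p , q) ∷ cs) =
  ((+ 1 / (p !)) {{p !≢0}} * (+ 1 / (q !)) {{q !≢0}}) * invFact cs

Δ : ∀ {n} → Vec Cell n → Poly n
Δ L = scaleP (invFact L)
        (det (λ i j → monomial i (proj₁ (lookup L j)) (proj₂ (lookup L j))))

-- Δ of the *set* of cells of a list: list them in lexicographic order
ΔSet : ∀ {n} → Vec Cell n → Poly n
ΔSet L = Δ (sortLex L)

lower : ∀ {n} → Vec Cell n → Fin n → ℕ → ℕ → Vec Cell n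
lower L s h k = L [ s ]≔ (proj₁ (lookup L s) ∸ h , proj₂ (lookup L s) ∸ k)

ε : ∀ {n} → Vec Cell n → Fin n → ℕ → ℕ → ℚ
ε L s h k =
  if (h ≤ᵇ proj₁ (lookup L s)) ∧ (k ≤ᵇ proj₂ (lookup L s)) ∧ distinct (lower L s h k)
  then sortSign (lower L s h k)
  else 0ℚ

-- Compare coefficients of x^a y^b.  The coefficient of Δ L is invFact L
-- times the determinant of the 0/1 incidence matrix [cell j of L = (a_i, b_i)].
-- Applying ∂_{x_s}^h ∂_{y_s}^k raises row s by (h, k) and contributes a
-- falling-factorial factor, which is also the factor produced by lowering
-- column j instead; the sum over the rows and the sum over the columns are
-- the two expansions of the derivative of det (A + t B) at t = 0, so they
-- agree.  Sorting a lowered column list costs the sign ε, a repeated cell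
-- makes the determinant vanish, and 1/p! · ff p h = 1/(p - h)! turns
-- invFact L into invFact of the lowered list.

module Submission where

open import Algebra.Bundles using (CommutativeRing)
open import Data.Bool using (true; false; T; _∧_; if_then_else_)
open import Data.Empty using (⊥-elim)
open import Data.Fin as Fin using (Fin; zero; suc; toℕ; punchIn; punchOut)
import Data.Fin.Properties as FinP
import Data.Integer as ℤ
open import Data.List using ([]; _∷_; _++_; map)
import Data.List.Properties as ListP
open import Data.Nat as ℕ using (ℕ; zero; suc; _+_; _∸_; _≤_; _!; _≤ᵇ_; NonZero)
open import Data.Nat.Properties using (_!≢0)
import Data.Nat.Properties as ℕP
open import Data.Product using (_×_; _,_; proj₁; proj₂; ∃; ∃₂)
open import Data.Product.Properties using (×-≡,≡←≡; ×-≡,≡→≡)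
open import Data.Rational as ℚ using (ℚ; 0ℚ; 1ℚ; _*_; -_; _/_; fromℚᵘ)
import Data.Rational.Properties as ℚP
open import Data.Rational.Solver using (module +-*-Solver)
import Data.Rational.Unnormalised as ℚᵘ
import Data.Rational.Unnormalised.Properties as ℚᵘP
open import Data.Sum using (_⊎_; inj₁; inj₂)
open import Data.Unit using (tt)
open import Data.Vec using (Vec; []; _∷_; lookup; insertAt; count; replicate; zipWith; _[_]≔_)
import Data.Vec.Properties as VecP
open import Data.Vec.Relation.Unary.All as All using (All; []; _∷_)
open import Function using (_∘_; id)
open import Level using (0ℓ)
open import Relation.Binary.Definitions using (tri<; tri≈; tri>)
open import Relation.Binary.PropositionalEquality
open import Relation.Nullary using (Dec; yes; no; does; ¬_; _×-dec_; map′)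
open import Relation.Nullary.Decidable using (dec-true; dec-false)
open import Relation.Unary using (Pred; Decidable)

open import Defs

open import Algebra.Properties.Semiring.Sum (CommutativeRing.semiring ℚP.+-*-commutativeRing)
  using (sum; sum-cong-≗; sum-remove; ∑-comm; ∑-distrib-+; *-distribˡ-sum)
open +-*-Solver

private
  variable
    n : ℕ

if-yes : ∀ {a} {A : Set a} {P : Set} (d : Dec P) {x y : A} → P → (if does d then x else y) ≡ x
if-yes d p rewrite dec-true d p = refl

if-no : ∀ {a} {A : Set a} {P : Set} (d : Dec P) {x y : A} → ¬ P → (if does d then x else y) ≡ y
if-no d ¬p rewrite dec-false d ¬p = refl

𝟙 : {P : Set} → Dec P → ℚ
𝟙 d = if does d then 1ℚ else 0ℚ

sgn-+ : ∀ m n → sgn (m + n) ≡ sgn m * sgn n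
sgn-+ zero    n = sym (ℚP.*-identityˡ (sgn n))
sgn-+ (suc m) n = trans (cong -_ (sgn-+ m n)) (ℚP.neg-distribˡ-* (sgn m) (sgn n))

sgn-square : ∀ n → sgn n * sgn n ≡ 1ℚ
sgn-square zero    = refl
sgn-square (suc n) = trans (solve 1 (λ a → (:- a) :* (:- a) := a :* a) refl (sgn n)) (sgn-square n)

-- Determinants of rational matrices

Matrix : ℕ → Set
Matrix n = Fin n → Fin n → ℚ

minor : Fin (suc n) → Matrix (suc n) → Matrix n
minor j A i j′ = A (suc i) (punchIn j j′)

detℚ : Matrix n → ℚ
detℚ {zero}  A = 1ℚ
detℚ {suc n} A = sum λ j → sgn (toℕ j) * (A zero j * detℚ (minor j A))

detℚ-cong : {A B : Matrix n} → (∀ i j → A i j ≡ B i j) → detℚ A ≡ detℚ B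
detℚ-cong {zero}  A≗B = refl
detℚ-cong {suc n} A≗B = sum-cong-≗ λ j →
  cong₂ (λ x y → sgn (toℕ j) * (x * y)) (A≗B zero j) (detℚ-cong λ i j′ → A≗B (suc i) (punchIn j j′))

_∘ᶜ_ : Matrix n → (Fin n → Fin n) → Matrix n
(A ∘ᶜ π) i j = A i (π j)

pullFirst : Fin (suc n) → Fin (suc n) → Fin (suc n)
pullFirst t zero    = t
pullFirst t (suc j) = punchIn t j

-- Once column punchIn t j is deleted, column t sits at position partner t j.
partner : Fin (suc (suc n)) → Fin (suc n) → Fin (suc n)
partner          zero    j       = zero
partner          (suc t) zero    = t
partner {suc n}  (suc t) (suc j) = suc (partner t j)

punchIn-partner : ∀ (t : Fin (suc (suc n))) j → punchIn (punchIn t j) (partner t j) ≡ t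
punchIn-partner         zero    j       = refl
punchIn-partner         (suc t) zero    = refl
punchIn-partner {suc n} (suc t) (suc j) = cong suc (punchIn-partner t j)

punchIn-punchIn-partner : ∀ (t : Fin (suc (suc n))) j i →
  punchIn (punchIn t j) (punchIn (partner t j) i) ≡ punchIn t (punchIn j i)
punchIn-punchIn-partner         zero    j       i       = refl
punchIn-punchIn-partner         (suc t) zero    i       = refl
punchIn-punchIn-partner {suc n} (suc t) (suc j) zero    = refl
punchIn-punchIn-partner {suc n} (suc t) (suc j) (suc i) = cong suc (punchIn-punchIn-partner t j i)

sgn-partner : ∀ (t : Fin (suc (suc n))) j →
  sgn (toℕ (punchIn t j)) * sgn (toℕ (partner t j)) ≡ sgn (toℕ t) * sgn (suc (toℕ j))
sgn-partner zero j = solve 1 (λ a → (:- a) :* con 1ℚ := con 1ℚ :* (:- a)) refl (sgn (toℕ j))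
sgn-partner (suc t) zero = solve 1 (λ a → con 1ℚ :* a := (:- a) :* (:- con 1ℚ)) refl (sgn (toℕ t))
sgn-partner {suc n} (suc t) (suc j) = begin
  - x * - y              ≡⟨ solve 2 (λ x y → (:- x) :* (:- y) := x :* y) refl x y ⟩
  x * y                  ≡⟨ sgn-partner t j ⟩
  a * - b                ≡⟨ solve 2 (λ a b → a :* (:- b) := (:- a) :* (:- (:- b))) refl a b ⟩
  - a * - - b            ∎
  where
  open ≡-Reasoning
  x = sgn (toℕ (punchIn t j))
  y = sgn (toℕ (partner t j))
  a = sgn (toℕ t)
  b = sgn (toℕ j)

detℚ-pullColumn : ∀ (A : Matrix (suc n)) t → detℚ A ≡ sgn (toℕ t) * detℚ (A ∘ᶜ pullFirst t)
detℚ-pullColumn A zero =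
  sym (trans (ℚP.*-identityˡ _) (detℚ-cong {A = A ∘ᶜ pullFirst zero} {B = A} λ { i zero → refl ; i (suc j) → refl }))
detℚ-pullColumn {suc n} A (suc t) = begin
  detℚ A                                   ≡⟨ sum-remove {i = suc t} f ⟩
  f (suc t) ℚ.+ sum (f ∘ punchIn (suc t))  ≡⟨ cong₂ ℚ._+_ (cong (σ *_) (sym (ℚP.*-identityˡ _))) (sum-cong-≗ moved) ⟩
  σ * g zero ℚ.+ sum (λ j → σ * g (suc j)) ≡⟨ cong ((σ * g zero) ℚ.+_) (sym (*-distribˡ-sum σ (g ∘ suc))) ⟩
  σ * g zero ℚ.+ σ * sum (g ∘ suc)         ≡⟨ sym (ℚP.*-distribˡ-+ σ (g zero) (sum (g ∘ suc))) ⟩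
  σ * detℚ A′                              ∎
  where
  open ≡-Reasoning
  σ = sgn (toℕ (suc t))
  A′ = A ∘ᶜ pullFirst (suc t)
  f g : Fin (suc (suc n)) → ℚ
  f j = sgn (toℕ j) * (A zero j * detℚ (minor j A))
  g j = sgn (toℕ j) * (A′ zero j * detℚ (minor j A′))
  moved : ∀ j → f (punchIn (suc t) j) ≡ σ * g (suc j)
  moved j = begin
    su * (a * detℚ (minor u A))            ≡⟨ cong (λ d → su * (a * d)) (detℚ-pullColumn (minor u A) p) ⟩
    su * (a * (sp * detℚ (minor u A ∘ᶜ pullFirst p)))
      ≡⟨ cong (λ d → su * (a * (sp * d))) (detℚ-cong {A = minor u A ∘ᶜ pullFirst p} {B = minor (suc j) A′} λ i →
           λ { zero → cong (A (suc i)) (punchIn-partner (suc t) j)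
             ; (suc m) → cong (A (suc i)) (punchIn-punchIn-partner (suc t) j m) }) ⟩
    su * (a * (sp * d′))                   ≡⟨ solve 4 (λ x y a d → x :* (a :* (y :* d)) := (x :* y) :* (a :* d)) refl su sp a d′ ⟩
    (su * sp) * (a * d′)                   ≡⟨ cong (_* (a * d′)) (sgn-partner (suc t) j) ⟩
    (σ * sgn (suc (toℕ j))) * (a * d′)     ≡⟨ ℚP.*-assoc σ _ _ ⟩
    σ * g (suc j)                          ∎
    where
    u = punchIn (suc t) j
    p = partner (suc t) j
    su = sgn (toℕ u)
    sp = sgn (toℕ p)
    a = A zero u
    d′ = detℚ (minor (suc j) A′)

x≡-x⇒x≡0 : ∀ x → x ≡ - x → x ≡ 0ℚ
x≡-x⇒x≡0 x x≡-x = begin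
  x                  ≡⟨ solve 1 (λ x → x := (x :+ x) :* con ½) refl x ⟩
  (x ℚ.+ x) * ½      ≡⟨ cong (λ y → (x ℚ.+ y) * ½) x≡-x ⟩
  (x ℚ.+ - x) * ½    ≡⟨ cong (_* ½) (ℚP.+-inverseʳ x) ⟩
  0ℚ * ½             ≡⟨ ℚP.*-zeroˡ ½ ⟩
  0ℚ                 ∎
  where
  open ≡-Reasoning
  ½ = ℤ.+ 1 / 2

detℚ-repeatedColumn : ∀ (A : Matrix (suc (suc n))) → (∀ i → A i zero ≡ A i (suc zero)) → detℚ A ≡ 0ℚ
detℚ-repeatedColumn A same = x≡-x⇒x≡0 (detℚ A) (begin
  detℚ A                                      ≡⟨ detℚ-pullColumn A (suc zero) ⟩
  - 1ℚ * detℚ (A ∘ᶜ pullFirst (suc zero))     ≡⟨ cong (- 1ℚ *_) (detℚ-cong {A = A ∘ᶜ pullFirst (suc zero)} {B = A} λ i →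
                                                   λ { zero → sym (same i) ; (suc zero) → same i ; (suc (suc j)) → refl }) ⟩
  - 1ℚ * detℚ A                               ≡⟨ solve 1 (λ d → (:- con 1ℚ) :* d := :- d) refl (detℚ A) ⟩
  - detℚ A                                    ∎)
  where open ≡-Reasoning

replaceRow : Fin n → Matrix n → Matrix n → Matrix n
replaceRow s B A i j = if does (i Fin.≟ s) then B i j else A i j

replaceColumn : Fin n → Matrix n → Matrix n → Matrix n
replaceColumn t B A i j = if does (j Fin.≟ t) then B i j else A i j

scaleRow : Fin n → ℚ → Matrix n → Matrix n
scaleRow s c A = replaceRow s (λ i j → c * A i j) A

scaleColumn : Fin n → ℚ → Matrix n → Matrix n
scaleColumn t c A = replaceColumn t (λ i j → c * A i j) A

sum-*ˡ : ∀ c (f : Fin n → ℚ) → sum (λ i → c * f i) ≡ c * sum f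
sum-*ˡ c f = sym (*-distribˡ-sum c f)

does-punchIn-≟ : ∀ (j : Fin (suc n)) m m′ → does (punchIn j m Fin.≟ punchIn j m′) ≡ does (m Fin.≟ m′)
does-punchIn-≟ j m m′ with m Fin.≟ m′
... | yes refl = dec-true (punchIn j m Fin.≟ punchIn j m) refl
... | no m≢m′  = dec-false (punchIn j m Fin.≟ punchIn j m′) (m≢m′ ∘ FinP.punchIn-injective j m m′)

replaceColumn-punchIn : ∀ t (B A : Matrix (suc n)) i m → replaceColumn t B A i (punchIn t m) ≡ A i (punchIn t m)
replaceColumn-punchIn t B A i m = if-no (punchIn t m Fin.≟ t) (FinP.punchInᵢ≢i t m)

minor-replaceColumn : ∀ j m (B A : Matrix (suc n)) i m′ →
  minor j (replaceColumn (punchIn j m) B A) i m′ ≡ replaceColumn m (minor j B) (minor j A) i m′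
minor-replaceColumn j m B A i m′ =
  cong (λ b → if b then B (suc i) (punchIn j m′) else A (suc i) (punchIn j m′)) (does-punchIn-≟ j m′ m)

detℚ-scaleRow : ∀ s c (A : Matrix n) → detℚ (scaleRow s c A) ≡ c * detℚ A
detℚ-scaleRow {suc n} zero c A = trans (sum-cong-≗ λ j →
  solve 4 (λ s c a d → s :* ((c :* a) :* d) := c :* (s :* (a :* d))) refl
    (sgn (toℕ j)) c (A zero j) (detℚ (minor j A))) (sum-*ˡ c λ j → sgn (toℕ j) * (A zero j * detℚ (minor j A)))
detℚ-scaleRow {suc n} (suc s) c A = trans (sum-cong-≗ λ j → begin
  sgn (toℕ j) * (A zero j * detℚ (scaleRow s c (minor j A)))
    ≡⟨ cong (λ d → sgn (toℕ j) * (A zero j * d)) (detℚ-scaleRow s c (minor j A)) ⟩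
  sgn (toℕ j) * (A zero j * (c * detℚ (minor j A)))
    ≡⟨ solve 4 (λ s c a d → s :* (a :* (c :* d)) := c :* (s :* (a :* d))) refl (sgn (toℕ j)) c (A zero j) (detℚ (minor j A)) ⟩
  c * (sgn (toℕ j) * (A zero j * detℚ (minor j A))) ∎) (sum-*ˡ c λ j → sgn (toℕ j) * (A zero j * detℚ (minor j A)))
  where open ≡-Reasoning

detℚ-scaleColumn : ∀ t c (A : Matrix n) → detℚ (scaleColumn t c A) ≡ c * detℚ A
detℚ-scaleColumn {suc n} t c A = trans (sum-cong-≗ scaledTerm) (sum-*ˡ c λ j → sgn (toℕ j) * (A zero j * detℚ (minor j A)))
  where
  open ≡-Reasoning
  scaledTerm : ∀ j → sgn (toℕ j) * (scaleColumn t c A zero j * detℚ (minor j (scaleColumn t c A)))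
                   ≡ c * (sgn (toℕ j) * (A zero j * detℚ (minor j A)))
  scaledTerm j with j Fin.≟ t
  ... | yes refl = begin
    sgn (toℕ j) * ((c * A zero j) * detℚ (minor j (scaleColumn j c A)))
      ≡⟨ cong (λ d → sgn (toℕ j) * ((c * A zero j) * d))
              (detℚ-cong {A = minor j (scaleColumn j c A)} {B = minor j A} λ i → replaceColumn-punchIn j (λ i j → c * A i j) A (suc i)) ⟩
    sgn (toℕ j) * ((c * A zero j) * detℚ (minor j A))
      ≡⟨ solve 4 (λ s c a d → s :* ((c :* a) :* d) := c :* (s :* (a :* d))) refl (sgn (toℕ j)) c (A zero j) (detℚ (minor j A)) ⟩
    c * (sgn (toℕ j) * (A zero j * detℚ (minor j A)))   ∎
  ... | no j≢t = begin
    sgn (toℕ j) * (A zero j * detℚ (minor j (scaleColumn t c A)))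
      ≡⟨ cong (λ t → sgn (toℕ j) * (A zero j * detℚ (minor j (scaleColumn t c A)))) (sym (FinP.punchIn-punchOut j≢t)) ⟩
    sgn (toℕ j) * (A zero j * detℚ (minor j (scaleColumn (punchIn j m) c A)))
      ≡⟨ cong (λ d → sgn (toℕ j) * (A zero j * d))
              (detℚ-cong {A = minor j (scaleColumn (punchIn j m) c A)} {B = scaleColumn m c (minor j A)}
                         (minor-replaceColumn j m (λ i j → c * A i j) A)) ⟩
    sgn (toℕ j) * (A zero j * detℚ (scaleColumn m c (minor j A)))
      ≡⟨ cong (λ d → sgn (toℕ j) * (A zero j * d)) (detℚ-scaleColumn m c (minor j A)) ⟩
    sgn (toℕ j) * (A zero j * (c * detℚ (minor j A)))
      ≡⟨ solve 4 (λ s c a d → s :* (a :* (c :* d)) := c :* (s :* (a :* d))) refl (sgn (toℕ j)) c (A zero j) (detℚ (minor j A)) ⟩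
    c * (sgn (toℕ j) * (A zero j * detℚ (minor j A)))   ∎
    where m = punchOut j≢t

-- Both sides are the derivative of t ↦ detℚ (A + t B) at 0, written as
-- Σ_{i,j} B i j · cofactor; the induction matches the first-row expansions.
∑-detℚ-replaceRow≡∑-detℚ-replaceColumn : ∀ (B A : Matrix n) →
  sum (λ s → detℚ (replaceRow s B A)) ≡ sum (λ t → detℚ (replaceColumn t B A))
∑-detℚ-replaceRow≡∑-detℚ-replaceColumn {zero}  B A = refl
∑-detℚ-replaceRow≡∑-detℚ-replaceColumn {suc n} B A = trans rowSide (sym columnSide)
  where
  open ≡-Reasoning
  diagonal : Fin (suc n) → ℚ
  diagonal j = sgn (toℕ j) * (B zero j * detℚ (minor j A))
  inMinor : Fin (suc n) → ℚ
  inMinor j = sgn (toℕ j) * (A zero j * sum (λ m → detℚ (replaceColumn m (minor j B) (minor j A))))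
  rowSide : sum (λ s → detℚ (replaceRow s B A)) ≡ sum diagonal ℚ.+ sum inMinor
  rowSide = cong (sum diagonal ℚ.+_) (begin
    sum (λ s → sum λ j → sgn (toℕ j) * (A zero j * detℚ (replaceRow s (minor j B) (minor j A))))
      ≡⟨ ∑-comm (λ s j → sgn (toℕ j) * (A zero j * detℚ (replaceRow s (minor j B) (minor j A)))) ⟩
    sum (λ j → sum λ s → sgn (toℕ j) * (A zero j * detℚ (replaceRow s (minor j B) (minor j A))))
      ≡⟨ sum-cong-≗ (λ j → begin
           sum (λ s → sgn (toℕ j) * (A zero j * detℚ (replaceRow s (minor j B) (minor j A))))
             ≡⟨ sum-*ˡ (sgn (toℕ j)) (λ s → A zero j * detℚ (replaceRow s (minor j B) (minor j A))) ⟩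
           sgn (toℕ j) * sum (λ s → A zero j * detℚ (replaceRow s (minor j B) (minor j A)))
             ≡⟨ cong (sgn (toℕ j) *_) (sum-*ˡ (A zero j) (λ s → detℚ (replaceRow s (minor j B) (minor j A)))) ⟩
           sgn (toℕ j) * (A zero j * sum (λ s → detℚ (replaceRow s (minor j B) (minor j A))))
             ≡⟨ cong (λ x → sgn (toℕ j) * (A zero j * x)) (∑-detℚ-replaceRow≡∑-detℚ-replaceColumn (minor j B) (minor j A)) ⟩
           inMinor j ∎) ⟩
    sum inMinor ∎)
  term : Fin (suc n) → Fin (suc n) → ℚ
  term t i = sgn (toℕ i) * (replaceColumn t B A zero i * detℚ (minor i (replaceColumn t B A)))
  diagonalTerm : ∀ i → term i i ≡ diagonal i
  diagonalTerm i = cong₂ (λ x d → sgn (toℕ i) * (x * d))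
    (if-yes (i Fin.≟ i) refl)
    (detℚ-cong {A = minor i (replaceColumn i B A)} {B = minor i A} λ i′ → replaceColumn-punchIn i B A (suc i′))
  offDiagonalTerms : ∀ i → sum (λ m → term (punchIn i m) i) ≡ inMinor i
  offDiagonalTerms i = begin
    sum (λ m → sgn (toℕ i) * (replaceColumn (punchIn i m) B A zero i * detℚ (minor i (replaceColumn (punchIn i m) B A))))
      ≡⟨ sum-cong-≗ (λ m → cong₂ (λ x d → sgn (toℕ i) * (x * d))
           (if-no (i Fin.≟ punchIn i m) (FinP.punchInᵢ≢i i m ∘ sym))
           (detℚ-cong {A = minor i (replaceColumn (punchIn i m) B A)} {B = replaceColumn m (minor i B) (minor i A)}
                      (minor-replaceColumn i m B A))) ⟩
    sum (λ m → sgn (toℕ i) * (A zero i * detℚ (replaceColumn m (minor i B) (minor i A))))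
      ≡⟨ sum-*ˡ (sgn (toℕ i)) (λ m → A zero i * detℚ (replaceColumn m (minor i B) (minor i A))) ⟩
    sgn (toℕ i) * sum (λ m → A zero i * detℚ (replaceColumn m (minor i B) (minor i A)))
      ≡⟨ cong (sgn (toℕ i) *_) (sum-*ˡ (A zero i) (λ m → detℚ (replaceColumn m (minor i B) (minor i A)))) ⟩
    inMinor i ∎
  columnSide : sum (λ t → detℚ (replaceColumn t B A)) ≡ sum diagonal ℚ.+ sum inMinor
  columnSide = begin
    sum (λ t → sum (term t))                                   ≡⟨ ∑-comm term ⟩
    sum (λ i → sum (λ t → term t i))                           ≡⟨ sum-cong-≗ (λ i → sum-remove {i = i} (λ t → term t i)) ⟩
    sum (λ i → term i i ℚ.+ sum (λ m → term (punchIn i m) i))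
      ≡⟨ ∑-distrib-+ (λ i → term i i) (λ i → sum (λ m → term (punchIn i m) i)) ⟩
    sum (λ i → term i i) ℚ.+ sum (λ i → sum (λ m → term (punchIn i m) i))
      ≡⟨ cong₂ ℚ._+_ (sum-cong-≗ diagonalTerm) (sum-cong-≗ offDiagonalTerms) ⟩
    sum diagonal ℚ.+ sum inMinor                               ∎

-- Incidence matrices of cells

-- Unlike _≟C_, its does-part computes to the conjunction of the two
-- componentwise tests.
_≟ᶜ_ : (c d : Cell) → Dec (c ≡ d)
c ≟ᶜ d = map′ ×-≡,≡→≡ ×-≡,≡←≡ ((proj₁ c ℕ.≟ proj₁ d) ×-dec (proj₂ c ℕ.≟ proj₂ d))

incidence : (Fin n → Cell) → (Fin n → Cell) → Matrix n
incidence C R i j = 𝟙 (C j ≟ᶜ R i)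

cellDet : (Fin n → Cell) → (Fin n → Cell) → ℚ
cellDet C R = detℚ (incidence C R)

infixl 6 _[_↦_]
_[_↦_] : ∀ {A : Set} → (Fin n → A) → Fin n → A → Fin n → A
(F [ s ↦ x ]) i = if does (i Fin.≟ s) then x else F i

raise : ℕ → ℕ → Cell → Cell
raise h k (p , q) = (p + h , q + k)

lowerCell : ℕ → ℕ → Cell → Cell
lowerCell h k (p , q) = (p ∸ h , q ∸ k)

-- ∂x^h ∂y^k x^p y^q = ∂-factor h k (p , q) · x^(p-h) y^(q-k)
∂-factor : ℕ → ℕ → Cell → ℚ
∂-factor h k (p , q) = (ℤ.+ ff p h / 1) * (ℤ.+ ff q k / 1)

ff-vanishes : ∀ {a h} → a ℕ.< h → ff a h ≡ 0
ff-vanishes {zero}  {suc h} _ = refl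
ff-vanishes {suc a} {suc h} (ℕ.s≤s a<h) = trans (cong (suc a ℕ.*_) (ff-vanishes a<h)) (ℕP.*-zeroʳ (suc a))

∂-factor-vanishes : ∀ h k c → ¬ (h ≤ proj₁ c × k ≤ proj₂ c) → ∂-factor h k c ≡ 0ℚ
∂-factor-vanishes h k (p , q) h,k≰c with h ℕ.≤? p | k ℕ.≤? q
... | yes h≤p | yes k≤q = ⊥-elim (h,k≰c (h≤p , k≤q))
... | no h≰p  | _       =
  trans (cong (λ f → (ℤ.+ f / 1) * (ℤ.+ ff q k / 1)) (ff-vanishes (ℕP.≰⇒> h≰p))) (ℚP.*-zeroˡ (ℤ.+ ff q k / 1))
... | yes _   | no k≰q  =
  trans (cong (λ f → (ℤ.+ ff p h / 1) * (ℤ.+ f / 1)) (ff-vanishes (ℕP.≰⇒> k≰q))) (ℚP.*-zeroʳ (ℤ.+ ff p h / 1))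

lowerCell-raise : ∀ h k c → lowerCell h k (raise h k c) ≡ c
lowerCell-raise h k (p , q) = cong₂ _,_ (ℕP.m+n∸n≡m p h) (ℕP.m+n∸n≡m q k)

raise-lowerCell : ∀ h k c → h ≤ proj₁ c → k ≤ proj₂ c → raise h k (lowerCell h k c) ≡ c
raise-lowerCell h k (p , q) h≤p k≤q = cong₂ _,_ (ℕP.m∸n+n≡m h≤p) (ℕP.m∸n+n≡m k≤q)

-- The entries on the two sides vanish unless c = raise h k r, in which
-- case both are ∂-factor h k c.
∂-factor-incidence : ∀ h k r c →
  ∂-factor h k (raise h k r) * 𝟙 (c ≟ᶜ raise h k r) ≡ ∂-factor h k c * 𝟙 (lowerCell h k c ≟ᶜ r)
∂-factor-incidence h k r c with c ≟ᶜ raise h k r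
... | yes c≡r↑ = begin
  w↑ * 𝟙 (c ≟ᶜ raise h k r)       ≡⟨ cong (w↑ *_) (if-yes (c ≟ᶜ raise h k r) c≡r↑) ⟩
  w↑ * 1ℚ
    ≡⟨ cong₂ _*_ (cong (∂-factor h k) (sym c≡r↑)) (sym (if-yes (lowerCell h k c ≟ᶜ r) c↓≡r)) ⟩
  ∂-factor h k c * 𝟙 (lowerCell h k c ≟ᶜ r) ∎
  where
  open ≡-Reasoning
  w↑ = ∂-factor h k (raise h k r)
  c↓≡r = trans (cong (lowerCell h k) c≡r↑) (lowerCell-raise h k r)
... | no c≢r↑ = trans (cong (∂-factor h k (raise h k r) *_) (if-no (c ≟ᶜ raise h k r) c≢r↑))
                  (trans (ℚP.*-zeroʳ (∂-factor h k (raise h k r))) (sym (vanishing (lowerCell h k c ≟ᶜ r))))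
  where
  vanishing : Dec (lowerCell h k c ≡ r) → ∂-factor h k c * 𝟙 (lowerCell h k c ≟ᶜ r) ≡ 0ℚ
  vanishing (no c↓≢r)  = trans (cong (∂-factor h k c *_) (if-no (lowerCell h k c ≟ᶜ r) c↓≢r)) (ℚP.*-zeroʳ (∂-factor h k c))
  vanishing (yes c↓≡r) = trans (cong (_* 𝟙 (lowerCell h k c ≟ᶜ r)) (∂-factor-vanishes h k c λ (h≤p , k≤q) →
                           c≢r↑ (trans (sym (raise-lowerCell h k c h≤p k≤q)) (cong (raise h k) c↓≡r))))
                           (ℚP.*-zeroˡ (𝟙 (lowerCell h k c ≟ᶜ r)))

-- The identity ∑-detℚ-replaceRow≡∑-detℚ-replaceColumn for the matrix with
-- entries ∂-factor h k (raise h k (R i)) · [C j ≡ raise h k (R i)], which by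
-- ∂-factor-incidence equal ∂-factor h k (C j) · [lowerCell h k (C j) ≡ R i].
∑-cellDet-raiseRow≡∑-cellDet-lowerColumn : ∀ h k (C R : Fin n → Cell) →
  sum (λ s → ∂-factor h k (raise h k (R s)) * cellDet C (R [ s ↦ raise h k (R s) ]))
    ≡ sum (λ t → ∂-factor h k (C t) * cellDet (C [ t ↦ lowerCell h k (C t) ]) R)
∑-cellDet-raiseRow≡∑-cellDet-lowerColumn h k C R = begin
  sum (λ s → w↑ s * cellDet C (R [ s ↦ raise h k (R s) ]))
    ≡⟨ sum-cong-≗ (λ s → trans (sym (detℚ-scaleRow s (w↑ s) _)) (detℚ-cong (rowEntries s))) ⟩
  sum (λ s → detℚ (replaceRow s B (incidence C R)))
    ≡⟨ ∑-detℚ-replaceRow≡∑-detℚ-replaceColumn B (incidence C R) ⟩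
  sum (λ t → detℚ (replaceColumn t B (incidence C R)))
    ≡⟨ sum-cong-≗ (λ t → trans (detℚ-cong (columnEntries t)) (detℚ-scaleColumn t (∂-factor h k (C t)) _)) ⟩
  sum (λ t → ∂-factor h k (C t) * cellDet (C [ t ↦ lowerCell h k (C t) ]) R) ∎
  where
  open ≡-Reasoning
  w↑ : Fin _ → ℚ
  w↑ s = ∂-factor h k (raise h k (R s))
  B : Matrix _
  B i j = w↑ i * 𝟙 (C j ≟ᶜ raise h k (R i))
  rowEntries : ∀ s i j → scaleRow s (w↑ s) (incidence C (R [ s ↦ raise h k (R s) ])) i j
                       ≡ replaceRow s B (incidence C R) i j
  rowEntries s i j with i Fin.≟ s
  ... | yes refl = refl
  ... | no _     = refl
  columnEntries : ∀ t i j → replaceColumn t B (incidence C R) i j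
                          ≡ scaleColumn t (∂-factor h k (C t)) (incidence (C [ t ↦ lowerCell h k (C t) ]) R) i j
  columnEntries t i j with j Fin.≟ t
  ... | yes refl = ∂-factor-incidence h k (R i) (C j)
  ... | no _     = refl

-- Signed rearrangements and sorting

-- ys arises from xs by moving single entries, and s is the sign of the
-- permutation.
infix 4 _↭[_]_
data _↭[_]_ {A : Set} : Vec A n → ℚ → Vec A n → Set where
  ↭-refl    : ∀ {xs : Vec A n} → xs ↭[ 1ℚ ] xs
  ↭-insert  : ∀ x (xs : Vec A n) t → (x ∷ xs) ↭[ sgn (toℕ t) ] insertAt xs t x
  ↭-extract : ∀ x (xs : Vec A n) t → insertAt xs t x ↭[ sgn (toℕ t) ] (x ∷ xs)
  ↭-trans   : ∀ {xs ys zs : Vec A n} {s s′} → xs ↭[ s ] ys → ys ↭[ s′ ] zs → xs ↭[ s′ * s ] zs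
  ↭-resign  : ∀ {xs ys : Vec A n} {s s′} → xs ↭[ s ] ys → s ≡ s′ → xs ↭[ s′ ] ys

↭-sym : ∀ {A : Set} {xs ys : Vec A n} {s} → xs ↭[ s ] ys → ys ↭[ s ] xs
↭-sym ↭-refl                = ↭-refl
↭-sym (↭-insert x xs t)     = ↭-extract x xs t
↭-sym (↭-extract x xs t)    = ↭-insert x xs t
↭-sym (↭-trans {s = s} {s′} p q) = ↭-resign (↭-trans (↭-sym q) (↭-sym p)) (ℚP.*-comm s s′)
↭-sym (↭-resign p s≡s′)     = ↭-resign (↭-sym p) s≡s′

-- A move behind y is a move to the front past y, then back past y to its place.
↭-cons : ∀ {A : Set} {xs ys : Vec A n} {s} y → xs ↭[ s ] ys → (y ∷ xs) ↭[ s ] (y ∷ ys)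
↭-cons y ↭-refl             = ↭-refl
↭-cons y (↭-insert x xs t)  = ↭-resign (↭-trans (↭-extract x (y ∷ xs) (suc zero)) (↭-insert x (y ∷ xs) (suc t)))
                                (solve 1 (λ a → (:- a) :* (:- con 1ℚ) := a) refl (sgn (toℕ t)))
↭-cons y (↭-extract x xs t) = ↭-resign (↭-trans (↭-extract x (y ∷ xs) (suc t)) (↭-insert x (y ∷ xs) (suc zero)))
                                (solve 1 (λ a → (:- con 1ℚ) :* (:- a) := a) refl (sgn (toℕ t)))
↭-cons y (↭-trans p q)      = ↭-trans (↭-cons y p) (↭-cons y q)
↭-cons y (↭-resign p s≡s′)  = ↭-resign (↭-cons y p) s≡s′

cellDet-insertAt : ∀ x (xs : Vec Cell n) t R →
  cellDet (lookup (insertAt xs t x)) R ≡ sgn (toℕ t) * cellDet (lookup (x ∷ xs)) R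
cellDet-insertAt x xs t R = trans (detℚ-pullColumn (incidence (lookup (insertAt xs t x)) R) t) (cong (sgn (toℕ t) *_)
  (detℚ-cong {A = incidence (lookup (insertAt xs t x)) R ∘ᶜ pullFirst t} {B = incidence (lookup (x ∷ xs)) R} λ i →
    λ { zero    → cong (λ c → 𝟙 (c ≟ᶜ R i)) (VecP.insertAt-lookup xs t x)
      ; (suc j) → cong (λ c → 𝟙 (c ≟ᶜ R i)) (VecP.insertAt-punchIn xs t x j) }))

cellDet-↭ : ∀ {xs ys : Vec Cell n} {s} → xs ↭[ s ] ys → ∀ R → cellDet (lookup ys) R ≡ s * cellDet (lookup xs) R
cellDet-↭ ↭-refl R = sym (ℚP.*-identityˡ _)
cellDet-↭ (↭-insert x xs t) R = cellDet-insertAt x xs t R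
cellDet-↭ (↭-extract x xs t) R = begin
  d                                          ≡⟨ trans (cong (_* d) (sgn-square (toℕ t))) (ℚP.*-identityˡ d) ⟨
  (σ * σ) * d                                ≡⟨ ℚP.*-assoc σ σ d ⟩
  σ * (σ * d)                                ≡⟨ cong (σ *_) (cellDet-insertAt x xs t R) ⟨
  σ * cellDet (lookup (insertAt xs t x)) R   ∎
  where
  open ≡-Reasoning
  σ = sgn (toℕ t)
  d = cellDet (lookup (x ∷ xs)) R
cellDet-↭ (↭-trans {s = s} {s′} p q) R =
  trans (cellDet-↭ q R) (trans (cong (s′ *_) (cellDet-↭ p R)) (sym (ℚP.*-assoc s′ s _)))
cellDet-↭ (↭-resign p refl) R = cellDet-↭ p R

<lex-asym : ∀ {c d} → c <lex d → ¬ d <lex c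
<lex-asym (inj₁ p<p′)       (inj₁ p′<p)       = ℕP.<-asym p<p′ p′<p
<lex-asym (inj₁ p<p′)       (inj₂ (refl , _)) = ℕP.<-irrefl refl p<p′
<lex-asym (inj₂ (refl , _)) (inj₁ p′<p)       = ℕP.<-irrefl refl p′<p
<lex-asym (inj₂ (_ , q<q′)) (inj₂ (_ , q′<q)) = ℕP.<-asym q<q′ q′<q

<lex-cotrans : ∀ {c d} e → c <lex d → c <lex e ⊎ e <lex d
<lex-cotrans {p , q} {p′ , q′} (p″ , q″) c<d with ℕP.<-cmp p p″
... | tri< p<p″ _ _ = inj₁ (inj₁ p<p″)
... | tri> _ _ p″<p = inj₂ (inj₁ (case c<d))
  where
  case : (p , q) <lex (p′ , q′) → p″ ℕ.< p′
  case (inj₁ p<p′)       = ℕP.<-trans p″<p p<p′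
  case (inj₂ (refl , _)) = p″<p
... | tri≈ _ refl _ with ℕP.<-cmp q q″
...   | tri< q<q″ _ _ = inj₁ (inj₂ (refl , q<q″))
...   | tri≈ _ refl _ = inj₂ c<d
...   | tri> _ _ q″<q = inj₂ (case c<d)
  where
  case : (p , q) <lex (p′ , q′) → (p , q″) <lex (p′ , q′)
  case (inj₁ p<p′)         = inj₁ p<p′
  case (inj₂ (refl , q<q′)) = inj₂ (refl , ℕP.<-trans q″<q q<q′)

≮lex-trans : ∀ {c d e} → ¬ d <lex c → ¬ e <lex d → ¬ e <lex c
≮lex-trans {d = d} d≮c e≮d e<c with <lex-cotrans d e<c
... | inj₁ e<d = e≮d e<d
... | inj₂ d<c = d≮c d<c

data Sorted : Vec Cell n → Set where
  []  : Sorted []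
  _∷_ : ∀ {x} {xs : Vec Cell n} → All (λ y → ¬ y <lex x) xs → Sorted xs → Sorted (x ∷ xs)

All-insertLex : ∀ {P : Pred Cell 0ℓ} {c} {v : Vec Cell n} → P c → All P v → All P (insertLex c v)
All-insertLex             pc []                    = pc ∷ []
All-insertLex {c = c} {d ∷ _} pc (pd ∷ pv) with does (d <lex? c)
... | true  = pd ∷ All-insertLex pc pv
... | false = pc ∷ pd ∷ pv

insertLex-< : ∀ {c d} (ds : Vec Cell n) → d <lex c → insertLex c (d ∷ ds) ≡ d ∷ insertLex c ds
insertLex-< {c = c} {d} ds d<c with does (d <lex? c) | dec-true (d <lex? c) d<c
... | true | refl = refl

insertLex-≮ : ∀ {c d} (ds : Vec Cell n) → ¬ d <lex c → insertLex c (d ∷ ds) ≡ c ∷ d ∷ ds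
insertLex-≮ {c = c} {d} ds d≮c with does (d <lex? c) | dec-false (d <lex? c) d≮c
... | false | refl = refl

insertLex-sorted : ∀ c {v : Vec Cell n} → Sorted v → Sorted (insertLex c v)
insertLex-sorted c []                         = [] ∷ []
insertLex-sorted c {d ∷ ds} (d≤ds ∷ sorted) with d <lex? c
... | yes d<c = subst Sorted (sym (insertLex-< ds d<c)) (All-insertLex (<lex-asym d<c) d≤ds ∷ insertLex-sorted c sorted)
... | no  d≮c = subst Sorted (sym (insertLex-≮ ds d≮c)) ((d≮c ∷ All.map (≮lex-trans d≮c) d≤ds) ∷ d≤ds ∷ sorted)

sortLex-sorted : ∀ (v : Vec Cell n) → Sorted (sortLex v)
sortLex-sorted []       = []
sortLex-sorted (c ∷ cs) = insertLex-sorted c (sortLex-sorted cs)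

count-∷-yes : ∀ {A : Set} {P : Pred A 0ℓ} (P? : Decidable P) {x} (xs : Vec A n) → P x → count P? (x ∷ xs) ≡ suc (count P? xs)
count-∷-yes P? {x} xs px rewrite dec-true (P? x) px = refl

count-∷-no : ∀ {A : Set} {P : Pred A 0ℓ} (P? : Decidable P) {x} (xs : Vec A n) → ¬ P x → count P? (x ∷ xs) ≡ count P? xs
count-∷-no P? {x} xs ¬px rewrite dec-false (P? x) ¬px = refl

count-none : ∀ {A : Set} {P : Pred A 0ℓ} (P? : Decidable P) {v : Vec A n} → All (¬_ ∘ P) v → count P? v ≡ 0
count-none P? []                   = refl
count-none P? {_ ∷ xs} (¬px ∷ ¬pv) = trans (count-∷-no P? xs ¬px) (count-none P? ¬pv)

if-suc-comm : ∀ b b′ (x : ℕ) →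
  (if b then suc else id) ((if b′ then suc else id) x) ≡ (if b′ then suc else id) ((if b then suc else id) x)
if-suc-comm true  true  x = refl
if-suc-comm true  false x = refl
if-suc-comm false true  x = refl
if-suc-comm false false x = refl

count-insertLex : ∀ {P : Pred Cell 0ℓ} (P? : Decidable P) c (v : Vec Cell n) → count P? (insertLex c v) ≡ count P? (c ∷ v)
count-insertLex P? c []       = refl
count-insertLex P? c (d ∷ ds) with does (d <lex? c)
... | false = refl
... | true  = trans (cong (if does (P? d) then suc else id) (count-insertLex P? c ds))
                    (if-suc-comm (does (P? d)) (does (P? c)) (count P? ds))

count-sortLex : ∀ {P : Pred Cell 0ℓ} (P? : Decidable P) (v : Vec Cell n) → count P? (sortLex v) ≡ count P? v
count-sortLex P? []       = refl
count-sortLex P? (c ∷ cs) =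
  trans (count-insertLex P? c (sortLex cs)) (cong (if does (P? c) then suc else id) (count-sortLex P? cs))

-- Inserting c into a sorted list moves it past exactly the entries below it.
insertLex-↭ : ∀ c {v : Vec Cell n} → Sorted v → (c ∷ v) ↭[ sgn (count (_<lex? c) v) ] insertLex c v
insertLex-↭ c []                        = ↭-refl
insertLex-↭ c {d ∷ ds} (d≤ds ∷ sorted) with d <lex? c
... | yes d<c = subst (λ v → (c ∷ d ∷ ds) ↭[ sgn (count (_<lex? c) (d ∷ ds)) ] v) (sym (insertLex-< ds d<c))
  (↭-resign (↭-trans (↭-insert c (d ∷ ds) (suc zero)) (↭-cons d (insertLex-↭ c sorted)))
    (trans (solve 1 (λ a → a :* (:- con 1ℚ) := :- a) refl (sgn (count (_<lex? c) ds)))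
           (cong sgn (sym (count-∷-yes (_<lex? c) ds d<c)))))
... | no  d≮c = subst (λ v → (c ∷ d ∷ ds) ↭[ sgn (count (_<lex? c) (d ∷ ds)) ] v) (sym (insertLex-≮ ds d≮c))
  (↭-resign ↭-refl (cong sgn (sym (trans (count-∷-no (_<lex? c) ds d≮c)
                                          (count-none (_<lex? c) (All.map (≮lex-trans d≮c) d≤ds))))))

sortLex-↭ : ∀ (v : Vec Cell n) → v ↭[ sortSign v ] sortLex v
sortLex-↭ []       = ↭-refl
sortLex-↭ (c ∷ cs) = ↭-resign (↭-trans (↭-cons c (sortLex-↭ cs)) (insertLex-↭ c (sortLex-sorted cs)))
  (trans (cong (λ m → sgn m * sgn (inversions cs)) (count-sortLex (_<lex? c) cs))
         (sym (sgn-+ (count (_<lex? c) cs) (inversions cs))))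

count≢0⇒insertAt : ∀ c (cs : Vec Cell (suc n)) → count (c ≟C_) cs ≢ 0 → ∃₂ λ w t → cs ≡ insertAt w t c
count≢0⇒insertAt c (d ∷ ds) count≢0 with c ≟C d
... | yes refl = ds , zero , refl
count≢0⇒insertAt c (d ∷ [])     count≢0 | no _ = ⊥-elim (count≢0 refl)
count≢0⇒insertAt c (d ∷ e ∷ es) count≢0 | no _ with count≢0⇒insertAt c (e ∷ es) count≢0
... | w , t , es≡ = d ∷ w , suc t , cong (d ∷_) es≡

nondistinct-↭ : ∀ (v : Vec Cell (suc (suc n))) → distinct v ≡ false →
  ∃₂ λ x (w : Vec Cell n) → ∃ λ s → v ↭[ s ] (x ∷ x ∷ w)
nondistinct-↭ (c ∷ cs) nondistinct with count (c ≟C_) cs in count≡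
... | suc _ with count≢0⇒insertAt c cs (λ count≡0 → ℕP.1+n≢0 (trans (sym count≡) count≡0))
...   | w , t , refl = c , w , _ , ↭-cons c (↭-extract c w t)
nondistinct-↭ {zero}  (c ∷ d ∷ []) () | zero
nondistinct-↭ {suc n} (c ∷ cs) nondistinct | zero with nondistinct-↭ cs nondistinct
... | x , w , s , cs↭ = x , c ∷ w , _ , ↭-trans (↭-cons c cs↭) (↭-insert c (x ∷ x ∷ w) (suc (suc zero)))

cellDet-nondistinct : ∀ (v : Vec Cell n) → distinct v ≡ false → ∀ R → cellDet (lookup v) R ≡ 0ℚ
cellDet-nondistinct (c ∷ d ∷ ds) nondistinct R with nondistinct-↭ (c ∷ d ∷ ds) nondistinct
... | x , w , s , v↭ = begin
  cellDet (lookup (c ∷ d ∷ ds)) R      ≡⟨ cellDet-↭ (↭-sym v↭) R ⟩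
  s * cellDet (lookup (x ∷ x ∷ w)) R   ≡⟨ cong (s *_) (detℚ-repeatedColumn (incidence (lookup (x ∷ x ∷ w)) R) λ _ → refl) ⟩
  s * 0ℚ                               ≡⟨ ℚP.*-zeroʳ s ⟩
  0ℚ                                   ∎
  where open ≡-Reasoning

-- Coefficients of polynomials

sameExponents? : (a′ b′ a b : Exps n) → Dec (a′ ≡ a × b′ ≡ b)
sameExponents? a′ b′ a b = VecP.≡-dec ℕP._≟_ a′ a ×-dec VecP.≡-dec ℕP._≟_ b′ b

termCoeff : Term n → Exps n → Exps n → ℚ
termCoeff (c , a′ , b′) a b = if does (sameExponents? a′ b′ a b) then c else 0ℚ

coeff-∷ : ∀ (t : Term n) P a b → coeff (t ∷ P) a b ≡ termCoeff t a b ℚ.+ coeff P a b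
coeff-∷ (c , a′ , b′) P a b with sameExponents? a′ b′ a b
... | yes same   = cong (ℚ._+ coeff P a b) (sym (if-yes (sameExponents? a′ b′ a b) same))
... | no  differ = sym (trans (cong (ℚ._+ coeff P a b) (if-no (sameExponents? a′ b′ a b) differ)) (ℚP.+-identityˡ (coeff P a b)))

coeff-++ : ∀ (P Q : Poly n) a b → coeff (P ++ Q) a b ≡ coeff P a b ℚ.+ coeff Q a b
coeff-++ []      Q a b = sym (ℚP.+-identityˡ (coeff Q a b))
coeff-++ (t ∷ P) Q a b = begin
  coeff (t ∷ P ++ Q) a b                          ≡⟨ coeff-∷ t (P ++ Q) a b ⟩
  termCoeff t a b ℚ.+ coeff (P ++ Q) a b          ≡⟨ cong (termCoeff t a b ℚ.+_) (coeff-++ P Q a b) ⟩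
  termCoeff t a b ℚ.+ (coeff P a b ℚ.+ coeff Q a b) ≡⟨ ℚP.+-assoc (termCoeff t a b) (coeff P a b) (coeff Q a b) ⟨
  termCoeff t a b ℚ.+ coeff P a b ℚ.+ coeff Q a b ≡⟨ cong (ℚ._+ coeff Q a b) (coeff-∷ t P a b) ⟨
  coeff (t ∷ P) a b ℚ.+ coeff Q a b               ∎
  where open ≡-Reasoning

coeff-sumP : ∀ {m} (f : Fin m → Poly n) a b → coeff (sumP f) a b ≡ sum (λ s → coeff (f s) a b)
coeff-sumP {m = zero}  f a b = refl
coeff-sumP {m = suc m} f a b =
  trans (coeff-++ (f zero) (sumP (f ∘ suc)) a b) (cong (coeff (f zero) a b ℚ.+_) (coeff-sumP (f ∘ suc) a b))

coeff-map : ∀ {m} (f : Term m → Term n) κ a b a₀ b₀ →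
  (∀ t → termCoeff (f t) a b ≡ κ * termCoeff t a₀ b₀) → ∀ P → coeff (map f P) a b ≡ κ * coeff P a₀ b₀
coeff-map f κ a b a₀ b₀ f-scales []      = sym (ℚP.*-zeroʳ κ)
coeff-map f κ a b a₀ b₀ f-scales (t ∷ P) = begin
  coeff (f t ∷ map f P) a b                               ≡⟨ coeff-∷ (f t) (map f P) a b ⟩
  termCoeff (f t) a b ℚ.+ coeff (map f P) a b             ≡⟨ cong₂ ℚ._+_ (f-scales t) (coeff-map f κ a b a₀ b₀ f-scales P) ⟩
  κ * termCoeff t a₀ b₀ ℚ.+ κ * coeff P a₀ b₀             ≡⟨ ℚP.*-distribˡ-+ κ (termCoeff t a₀ b₀) (coeff P a₀ b₀) ⟨
  κ * (termCoeff t a₀ b₀ ℚ.+ coeff P a₀ b₀)               ≡⟨ cong (κ *_) (coeff-∷ t P a₀ b₀) ⟨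
  κ * coeff (t ∷ P) a₀ b₀                                 ∎
  where open ≡-Reasoning

coeff-scaleP : ∀ c (P : Poly n) a b → coeff (scaleP c P) a b ≡ c * coeff P a b
coeff-scaleP c P a b = coeff-map _ c a b a b (λ { (d , a′ , b′) → scales d a′ b′ }) P
  where
  scales : ∀ d a′ b′ → termCoeff (c * d , a′ , b′) a b ≡ c * termCoeff (d , a′ , b′) a b
  scales d a′ b′ with does (sameExponents? a′ b′ a b)
  ... | true  = refl
  ... | false = sym (ℚP.*-zeroʳ c)

liftTerm : Term n → Term (suc n)
liftTerm (c , a , b) = (c , 0 ∷ a , 0 ∷ b)

map-liftTerm-*P : ∀ (P Q : Poly n) → map liftTerm (P *P Q) ≡ map liftTerm P *P map liftTerm Q
map-liftTerm-*P []      Q = refl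
map-liftTerm-*P (t ∷ P) Q = trans (ListP.map-++ liftTerm _ (P *P Q))
  (cong₂ _++_ (trans (sym (ListP.map-∘ Q)) (trans (ListP.map-cong (λ _ → refl) Q) (ListP.map-∘ Q)))
              (map-liftTerm-*P P Q))

map-liftTerm-scaleP : ∀ c (P : Poly n) → map liftTerm (scaleP c P) ≡ scaleP c (map liftTerm P)
map-liftTerm-scaleP c P = trans (sym (ListP.map-∘ P)) (trans (ListP.map-cong (λ _ → refl) P) (ListP.map-∘ P))

map-liftTerm-sumP : ∀ {m} (f : Fin m → Poly n) → map liftTerm (sumP f) ≡ sumP (map liftTerm ∘ f)
map-liftTerm-sumP {m = zero}  f = refl
map-liftTerm-sumP {m = suc m} f =
  trans (ListP.map-++ liftTerm (f zero) (sumP (f ∘ suc))) (cong (map liftTerm (f zero) ++_) (map-liftTerm-sumP (f ∘ suc)))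

sumP-cong : ∀ {m} {f g : Fin m → Poly n} → (∀ s → f s ≡ g s) → sumP f ≡ sumP g
sumP-cong {m = zero}  f≗g = refl
sumP-cong {m = suc m} f≗g = cong₂ _++_ (f≗g zero) (sumP-cong (f≗g ∘ suc))

det-liftTerm : ∀ {m} (M : Fin m → Fin m → Poly n) → det (λ i j → map liftTerm (M i j)) ≡ map liftTerm (det M)
det-liftTerm {m = zero}  M = refl
det-liftTerm {m = suc m} M = sym (trans (map-liftTerm-sumP (λ j → scaleP (sgn (toℕ j)) (M zero j *P minorDet j)))
  (sumP-cong λ j → trans (map-liftTerm-scaleP (sgn (toℕ j)) (M zero j *P minorDet j)) (cong (scaleP (sgn (toℕ j)))
    (trans (map-liftTerm-*P (M zero j) (minorDet j)) (cong (map liftTerm (M zero j) *P_)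
      (sym (det-liftTerm (λ i j′ → M (suc i) (punchIn j j′)))))))))
  where
  minorDet : Fin (suc m) → Poly _
  minorDet j = det (λ i j′ → M (suc i) (punchIn j j′))

if-∧-factor : ∀ x y u v (d : ℚ) →
  (if (x ∧ u) ∧ (y ∧ v) then d else 0ℚ) ≡ (if x ∧ y then 1ℚ else 0ℚ) * (if u ∧ v then d else 0ℚ)
if-∧-factor true  true  u     v d = sym (ℚP.*-identityˡ (if u ∧ v then d else 0ℚ))
if-∧-factor true  false true  v d = sym (ℚP.*-zeroˡ (if v then d else 0ℚ))
if-∧-factor true  false false v d = sym (ℚP.*-zeroˡ 0ℚ)
if-∧-factor false y     u     v d = sym (ℚP.*-zeroˡ (if u ∧ v then d else 0ℚ))

termCoeff-∷ : ∀ d p q a₀ b₀ (a′ b′ a b : Exps n) →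
  termCoeff (d , p ∷ a′ , q ∷ b′) (a₀ ∷ a) (b₀ ∷ b) ≡ 𝟙 ((p , q) ≟ᶜ (a₀ , b₀)) * termCoeff (d , a′ , b′) a b
termCoeff-∷ d p q a₀ b₀ a′ b′ a b = if-∧-factor (does (p ℕ.≟ a₀)) (does (q ℕ.≟ b₀))
  (does (VecP.≡-dec ℕP._≟_ a′ a)) (does (VecP.≡-dec ℕP._≟_ b′ b)) d

cellsOf : Exps n → Exps n → Fin n → Cell
cellsOf a b i = (lookup a i , lookup b i)

-- The terms of map liftTerm Q have exponent 0 in x₀ and y₀, so multiplying
-- by x₀^p y₀^q just prepends p and q to their exponents.
coeff-monomial₀-*P : ∀ p q (Q : Poly n) a₀ b₀ a b →
  coeff (monomial zero p q *P map liftTerm Q) (a₀ ∷ a) (b₀ ∷ b) ≡ 𝟙 ((p , q) ≟ᶜ (a₀ , b₀)) * coeff Q a b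
coeff-monomial₀-*P {n} p q Q a₀ b₀ a b = begin
  coeff (map mul (map liftTerm Q) ++ []) (a₀ ∷ a) (b₀ ∷ b)    ≡⟨ coeff-++ (map mul (map liftTerm Q)) [] (a₀ ∷ a) (b₀ ∷ b) ⟩
  coeff (map mul (map liftTerm Q)) (a₀ ∷ a) (b₀ ∷ b) ℚ.+ 0ℚ   ≡⟨ ℚP.+-identityʳ _ ⟩
  coeff (map mul (map liftTerm Q)) (a₀ ∷ a) (b₀ ∷ b)          ≡⟨ cong (λ P → coeff P (a₀ ∷ a) (b₀ ∷ b)) (ListP.map-∘ Q) ⟨
  coeff (map (mul ∘ liftTerm) Q) (a₀ ∷ a) (b₀ ∷ b)
    ≡⟨ coeff-map (mul ∘ liftTerm) (𝟙 ((p , q) ≟ᶜ (a₀ , b₀))) (a₀ ∷ a) (b₀ ∷ b) a b scales Q ⟩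
  𝟙 ((p , q) ≟ᶜ (a₀ , b₀)) * coeff Q a b                      ∎
  where
  open ≡-Reasoning
  mul : Term (suc n) → Term (suc n)
  mul (d , a′ , b′) = (1ℚ * d , zipWith _+_ (p ∷ replicate n 0) a′ , zipWith _+_ (q ∷ replicate n 0) b′)
  scales : ∀ t → termCoeff (mul (liftTerm t)) (a₀ ∷ a) (b₀ ∷ b) ≡ 𝟙 ((p , q) ≟ᶜ (a₀ , b₀)) * termCoeff t a b
  scales (d , a′ , b′) = trans
    (cong (λ t → termCoeff t (a₀ ∷ a) (b₀ ∷ b))
      (cong₂ _,_ (ℚP.*-identityˡ d)
        (cong₂ _,_ (cong₂ _∷_ (ℕP.+-identityʳ p) (VecP.zipWith-identityˡ ℕP.+-identityˡ a′))
                   (cong₂ _∷_ (ℕP.+-identityʳ q) (VecP.zipWith-identityˡ ℕP.+-identityˡ b′)))))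
    (termCoeff-∷ d p q a₀ b₀ a′ b′ a b)

coeff-det : ∀ (C : Fin n → Cell) a b →
  coeff (det (λ i j → monomial i (proj₁ (C j)) (proj₂ (C j)))) a b ≡ cellDet C (cellsOf a b)
coeff-det {zero}  C [] [] = refl
coeff-det {suc n} C (a₀ ∷ a) (b₀ ∷ b) =
  trans (coeff-sumP (λ j → scaleP (sgn (toℕ j)) (M C zero j *P minorDet j)) (a₀ ∷ a) (b₀ ∷ b)) (sum-cong-≗ λ j → begin
    coeff (scaleP (sgn (toℕ j)) (monomial zero (proj₁ (C j)) (proj₂ (C j)) *P minorDet j)) (a₀ ∷ a) (b₀ ∷ b)
      ≡⟨ coeff-scaleP (sgn (toℕ j)) (M C zero j *P minorDet j) (a₀ ∷ a) (b₀ ∷ b) ⟩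
    sgn (toℕ j) * coeff (monomial zero (proj₁ (C j)) (proj₂ (C j)) *P minorDet j) (a₀ ∷ a) (b₀ ∷ b)
      ≡⟨ cong (λ P → sgn (toℕ j) * coeff (monomial zero (proj₁ (C j)) (proj₂ (C j)) *P P) (a₀ ∷ a) (b₀ ∷ b))
              (det-liftTerm (λ i j′ → monomial i (proj₁ (C (punchIn j j′))) (proj₂ (C (punchIn j j′))))) ⟩
    sgn (toℕ j) * coeff (monomial zero (proj₁ (C j)) (proj₂ (C j)) *P map liftTerm (det (M (C ∘ punchIn j)))) (a₀ ∷ a) (b₀ ∷ b)
      ≡⟨ cong (sgn (toℕ j) *_) (coeff-monomial₀-*P (proj₁ (C j)) (proj₂ (C j)) (det (M (C ∘ punchIn j))) a₀ b₀ a b) ⟩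
    sgn (toℕ j) * (𝟙 (C j ≟ᶜ (a₀ , b₀)) * coeff (det (M (C ∘ punchIn j))) a b)
      ≡⟨ cong (λ d → sgn (toℕ j) * (𝟙 (C j ≟ᶜ (a₀ , b₀)) * d)) (coeff-det (C ∘ punchIn j) a b) ⟩
    sgn (toℕ j) * (𝟙 (C j ≟ᶜ (a₀ , b₀)) * cellDet (C ∘ punchIn j) (cellsOf a b)) ∎)
  where
  open ≡-Reasoning
  M : ∀ {m} → (Fin m → Cell) → Fin m → Fin m → Poly m
  M C i j = monomial i (proj₁ (C j)) (proj₂ (C j))
  minorDet : Fin (suc n) → Poly (suc n)
  minorDet j = det (λ i j′ → M C (suc i) (punchIn j j′))

raiseAt lowerAt : Exps n → Fin n → ℕ → Exps n
raiseAt a s h = a [ s ]≔ (lookup a s + h)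
lowerAt a s h = a [ s ]≔ (lookup a s ∸ h)

[]≔-[]≔-lookup : ∀ {A : Set} (v : Vec A n) s x y → y ≡ lookup v s → (v [ s ]≔ x) [ s ]≔ y ≡ v
[]≔-[]≔-lookup v s x y y≡vₛ = trans (VecP.[]≔-idempotent v s) (trans (cong (v [ s ]≔_) y≡vₛ) (VecP.[]≔-lookup v s))

lowerAt-raiseAt : ∀ (a : Exps n) s h → lowerAt (raiseAt a s h) s h ≡ a
lowerAt-raiseAt a s h = []≔-[]≔-lookup a s _ _ (trans (cong (_∸ h) (VecP.lookup∘updateAt s a)) (ℕP.m+n∸n≡m _ h))

raiseAt-lowerAt : ∀ (a : Exps n) s h → h ≤ lookup a s → raiseAt (lowerAt a s h) s h ≡ a
raiseAt-lowerAt a s h h≤aₛ = []≔-[]≔-lookup a s _ _ (trans (cong (_+ h) (VecP.lookup∘updateAt s a)) (ℕP.m∸n+n≡m h≤aₛ))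

termCoeff-0ℚ : ∀ (a′ b′ a b : Exps n) → termCoeff (0ℚ , a′ , b′) a b ≡ 0ℚ
termCoeff-0ℚ a′ b′ a b with does (sameExponents? a′ b′ a b)
... | true  = refl
... | false = refl

-- A term of ∂ P has exponents (a, b) exactly when the term of P it came
-- from has the raised exponents; all other terms either miss (a, b) or
-- are killed by a vanishing falling factorial.
coeff-∂ : ∀ s h k (P : Poly n) a b →
  coeff (∂ s h k P) a b ≡ ∂-factor h k (raise h k (cellsOf a b s)) * coeff P (raiseAt a s h) (raiseAt b s k)
coeff-∂ s h k P a b = coeff-map _ κ a b a↑ b↑ (λ { (c , a′ , b′) → scales c a′ b′ (sameExponents? a′ b′ a↑ b↑) }) P
  where
  κ = ∂-factor h k (raise h k (cellsOf a b s))
  a↑ = raiseAt a s h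
  b↑ = raiseAt b s k
  scales : ∀ c a′ b′ → Dec (a′ ≡ a↑ × b′ ≡ b↑) →
    termCoeff (c * ∂-factor h k (cellsOf a′ b′ s) , lowerAt a′ s h , lowerAt b′ s k) a b ≡ κ * termCoeff (c , a′ , b′) a↑ b↑
  scales c _ _ (yes (refl , refl)) = begin
    termCoeff (c * ∂-factor h k (cellsOf a↑ b↑ s) , lowerAt a↑ s h , lowerAt b↑ s k) a b
      ≡⟨ if-yes (sameExponents? (lowerAt a↑ s h) (lowerAt b↑ s k) a b) (lowerAt-raiseAt a s h , lowerAt-raiseAt b s k) ⟩
    c * ∂-factor h k (cellsOf a↑ b↑ s)
      ≡⟨ cong (λ x → c * ∂-factor h k x) (cong₂ _,_ (VecP.lookup∘updateAt s a) (VecP.lookup∘updateAt s b)) ⟩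
    c * κ
      ≡⟨ ℚP.*-comm c κ ⟩
    κ * c
      ≡⟨ cong (κ *_) (if-yes (sameExponents? a↑ b↑ a↑ b↑) (refl , refl)) ⟨
    κ * termCoeff (c , a↑ , b↑) a↑ b↑ ∎
    where open ≡-Reasoning
  scales c a′ b′ (no differ) = trans lhs≡0 (sym (trans (cong (κ *_) (if-no (sameExponents? a′ b′ a↑ b↑) differ)) (ℚP.*-zeroʳ κ)))
    where
    vanishing : ¬ (h ≤ lookup a′ s × k ≤ lookup b′ s) →
      termCoeff (c * ∂-factor h k (cellsOf a′ b′ s) , lowerAt a′ s h , lowerAt b′ s k) a b ≡ 0ℚ
    vanishing h,k≰ = trans (cong (λ x → termCoeff (x , lowerAt a′ s h , lowerAt b′ s k) a b)
      (trans (cong (c *_) (∂-factor-vanishes h k (cellsOf a′ b′ s) h,k≰)) (ℚP.*-zeroʳ c)))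
      (termCoeff-0ℚ (lowerAt a′ s h) (lowerAt b′ s k) a b)
    lhs≡0 : termCoeff (c * ∂-factor h k (cellsOf a′ b′ s) , lowerAt a′ s h , lowerAt b′ s k) a b ≡ 0ℚ
    lhs≡0 with h ℕ.≤? lookup a′ s | k ℕ.≤? lookup b′ s
    ... | yes h≤ | yes k≤ = if-no (sameExponents? (lowerAt a′ s h) (lowerAt b′ s k) a b) λ where
      (refl , refl) → differ (sym (raiseAt-lowerAt a′ s h h≤) , sym (raiseAt-lowerAt b′ s k k≤))
    ... | no h≰ | _ = vanishing λ (h≤ , _) → h≰ h≤
    ... | yes _ | no k≰ = vanishing λ (_ , k≤) → k≰ k≤

-- Factorials

fromℚᵘ-* : ∀ x y → fromℚᵘ (x ℚᵘ.* y) ≡ fromℚᵘ x * fromℚᵘ y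
fromℚᵘ-* x y = ℚP.toℚᵘ-injective (ℚᵘP.≃-trans (ℚP.toℚᵘ-fromℚᵘ (x ℚᵘ.* y))
  (ℚᵘP.≃-trans (ℚᵘP.*-cong (ℚᵘP.≃-sym (ℚP.toℚᵘ-fromℚᵘ x)) (ℚᵘP.≃-sym (ℚP.toℚᵘ-fromℚᵘ y)))
    (ℚᵘP.≃-sym (ℚP.toℚᵘ-homo-* (fromℚᵘ x) (fromℚᵘ y)))))

-- fromℚᵘ (mkℚᵘ i (d - 1)) is i / d by definition, so the identity can be
-- checked on unnormalised fractions.
1/[m*n]*m≡1/n : ∀ m n .{{_ : NonZero m}} .{{_ : NonZero n}} →
  (ℤ.+ 1 / (m ℕ.* n)) {{ℕP.m*n≢0 m n}} * (ℤ.+ m / 1) ≡ ℤ.+ 1 / n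
1/[m*n]*m≡1/n (suc m) (suc n) =
  trans (sym (fromℚᵘ-* (ℚᵘ.mkℚᵘ (ℤ.+ 1) (n + m ℕ.* suc n)) (ℚᵘ.mkℚᵘ (ℤ.+ suc m) 0))) (ℚP.fromℚᵘ-cong unnormalised)
  where
  unnormalised : ℚᵘ.mkℚᵘ (ℤ.+ 1) (n + m ℕ.* suc n) ℚᵘ.* ℚᵘ.mkℚᵘ (ℤ.+ suc m) 0 ℚᵘ.≃ ℚᵘ.mkℚᵘ (ℤ.+ 1) n
  unnormalised = ℚᵘ.*≡* (cong ℤ.+_ (trans (cong (ℕ._* suc n) (ℕP.*-identityˡ (suc m)))
                                         (sym (trans (ℕP.*-identityˡ _) (ℕP.*-identityʳ _)))))

ff-*-! : ∀ p h → h ≤ p → ff p h ℕ.* (p ∸ h) ! ≡ p !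
ff-*-! p       zero    _           = ℕP.+-identityʳ (p !)
ff-*-! (suc p) (suc h) (ℕ.s≤s h≤p) = trans (ℕP.*-assoc (suc p) (ff p h) ((p ∸ h) !)) (cong (suc p ℕ.*_) (ff-*-! p h h≤p))

ff-nonZero : ∀ p h → h ≤ p → NonZero (ff p h)
ff-nonZero p       zero    _           = _
ff-nonZero (suc p) (suc h) (ℕ.s≤s h≤p) = ℕP.m*n≢0 (suc p) (ff p h) {{_}} {{ff-nonZero p h h≤p}}

1/!*ff≡1/! : ∀ p h → h ≤ p → (ℤ.+ 1 / p !) {{p !≢0}} * (ℤ.+ ff p h / 1) ≡ (ℤ.+ 1 / (p ∸ h) !) {{(p ∸ h) !≢0}}
1/!*ff≡1/! p h h≤p = trans (cong (_* (ℤ.+ ff p h / 1)) 1/p!≡)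
  (1/[m*n]*m≡1/n (ff p h) ((p ∸ h) !) {{ff-nonZero p h h≤p}} {{(p ∸ h) !≢0}})
  where
  1/p!≡ : (ℤ.+ 1 / p !) {{p !≢0}}
        ≡ (ℤ.+ 1 / (ff p h ℕ.* (p ∸ h) !)) {{ℕP.m*n≢0 (ff p h) ((p ∸ h) !) {{ff-nonZero p h h≤p}} {{(p ∸ h) !≢0}}}}
  1/p!≡ = ℚP./-cong {p₁ = ℤ.+ 1} {p₂ = ℤ.+ 1} {{p !≢0}} {{ℕP.m*n≢0 (ff p h) ((p ∸ h) !) {{ff-nonZero p h h≤p}} {{(p ∸ h) !≢0}}}}
            refl (sym (ff-*-! p h h≤p))

cellFactor : Cell → ℚ
cellFactor (p , q) = (ℤ.+ 1 / (p !)) {{p !≢0}} * (ℤ.+ 1 / (q !)) {{q !≢0}}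

invFact-insertLex : ∀ c (v : Vec Cell n) → invFact (insertLex c v) ≡ cellFactor c * invFact v
invFact-insertLex c []       = refl
invFact-insertLex c (d ∷ ds) with d <lex? c
... | yes d<c = trans (cong invFact (insertLex-< ds d<c))
  (trans (cong (cellFactor d *_) (invFact-insertLex c ds))
    (solve 3 (λ x y z → x :* (y :* z) := y :* (x :* z)) refl (cellFactor d) (cellFactor c) (invFact ds)))
... | no d≮c = cong invFact (insertLex-≮ ds d≮c)

invFact-sortLex : ∀ (v : Vec Cell n) → invFact (sortLex v) ≡ invFact v
invFact-sortLex []       = refl
invFact-sortLex (c ∷ cs) = trans (invFact-insertLex c (sortLex cs)) (cong (cellFactor c *_) (invFact-sortLex cs))

invFact-lower : ∀ (L : Vec Cell n) j h k → h ≤ proj₁ (lookup L j) → k ≤ proj₂ (lookup L j) →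
  invFact L * ∂-factor h k (lookup L j) ≡ invFact (lower L j h k)
invFact-lower ((p , q) ∷ cs) zero h k h≤p k≤q = trans
  (solve 5 (λ x y u v w → (x :* y) :* w :* (u :* v) := (x :* u) :* (y :* v) :* w) refl
    ((ℤ.+ 1 / (p !)) {{p !≢0}}) ((ℤ.+ 1 / (q !)) {{q !≢0}}) (ℤ.+ ff p h / 1) (ℤ.+ ff q k / 1) (invFact cs))
  (cong₂ (λ x y → x * y * invFact cs) (1/!*ff≡1/! p h h≤p) (1/!*ff≡1/! q k k≤q))
invFact-lower (c ∷ cs) (suc j) h k h≤p k≤q =
  trans (ℚP.*-assoc (cellFactor c) (invFact cs) _) (cong (cellFactor c *_) (invFact-lower cs j h k h≤p k≤q))

-- Assembling the coefficients

lookup-[]≔ : ∀ {A : Set} (v : Vec A n) s x i → lookup (v [ s ]≔ x) i ≡ (lookup v [ s ↦ x ]) i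
lookup-[]≔ (y ∷ v) zero    x zero    = refl
lookup-[]≔ (y ∷ v) zero    x (suc i) = refl
lookup-[]≔ (y ∷ v) (suc s) x zero    = refl
lookup-[]≔ (y ∷ v) (suc s) x (suc i) = lookup-[]≔ v s x i

cellsOf-raiseAt : ∀ (a b : Exps n) s h k i →
  cellsOf (raiseAt a s h) (raiseAt b s k) i ≡ (cellsOf a b [ s ↦ raise h k (cellsOf a b s) ]) i
cellsOf-raiseAt (x ∷ a) (y ∷ b) zero    h k zero    = refl
cellsOf-raiseAt (x ∷ a) (y ∷ b) zero    h k (suc i) = refl
cellsOf-raiseAt (x ∷ a) (y ∷ b) (suc s) h k zero    = refl
cellsOf-raiseAt (x ∷ a) (y ∷ b) (suc s) h k (suc i) = cellsOf-raiseAt a b s h k i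

cellDet-cong : ∀ {C C′ R R′ : Fin n → Cell} → (∀ j → C j ≡ C′ j) → (∀ i → R i ≡ R′ i) →
  cellDet C R ≡ cellDet C′ R′
cellDet-cong {C = C} {C′} {R} {R′} C≗C′ R≗R′ =
  detℚ-cong {A = incidence C R} {B = incidence C′ R′} λ i j → cong₂ (λ c r → 𝟙 (c ≟ᶜ r)) (C≗C′ j) (R≗R′ i)

cellDet-sortLex : ∀ (v : Vec Cell n) R → cellDet (lookup v) R ≡ sortSign v * cellDet (lookup (sortLex v)) R
cellDet-sortLex v = cellDet-↭ (↭-sym (sortLex-↭ v))

coeff-Δ : ∀ (L : Vec Cell n) a b → coeff (Δ L) a b ≡ invFact L * cellDet (lookup L) (cellsOf a b)
coeff-Δ L a b = trans (coeff-scaleP (invFact L) (det (λ i j → monomial i (proj₁ (lookup L j)) (proj₂ (lookup L j)))) a b)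
                      (cong (invFact L *_) (coeff-det (lookup L) a b))

≤ᵇ≡true⇒≤ : ∀ {m n} → (m ≤ᵇ n) ≡ true → m ≤ n
≤ᵇ≡true⇒≤ {m} {n} m≤ᵇn = ℕP.≤ᵇ⇒≤ m n (subst T (sym m≤ᵇn) tt)

≤ᵇ≡false⇒≰ : ∀ {m n} → (m ≤ᵇ n) ≡ false → ¬ m ≤ n
≤ᵇ≡false⇒≰ m≰ᵇn m≤n = subst T m≰ᵇn (ℕP.≤⇒≤ᵇ m≤n)

ε-lowering-zero : ∀ (L : Vec Cell n) j h k R →
  ∂-factor h k (lookup L j) * cellDet (lookup (lower L j h k)) R ≡ 0ℚ →
  invFact L * (∂-factor h k (lookup L j) * cellDet (lookup (lower L j h k)) R)
    ≡ 0ℚ * (invFact (sortLex (lower L j h k)) * cellDet (lookup (sortLex (lower L j h k))) R)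
ε-lowering-zero L j h k R product≡0 =
  trans (cong (invFact L *_) product≡0) (trans (ℚP.*-zeroʳ (invFact L))
    (sym (ℚP.*-zeroˡ (invFact (sortLex (lower L j h k)) * cellDet (lookup (sortLex (lower L j h k))) R))))

-- Whenever ε vanishes, so does the left side: through the falling
-- factorial or through the repeated column.
ε-lowering : ∀ (L : Vec Cell n) j h k R →
  invFact L * (∂-factor h k (lookup L j) * cellDet (lookup (lower L j h k)) R)
    ≡ ε L j h k * (invFact (sortLex (lower L j h k)) * cellDet (lookup (sortLex (lower L j h k))) R)
ε-lowering L j h k R with h ≤ᵇ proj₁ (lookup L j) in h≤ᵇp | k ≤ᵇ proj₂ (lookup L j) in k≤ᵇq
... | true | true with distinct (lower L j h k) in lowered-distinct
...   | true = begin
  invFact L * (w * cellDet (lookup low) R)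
    ≡⟨ ℚP.*-assoc (invFact L) w (cellDet (lookup low) R) ⟨
  invFact L * w * cellDet (lookup low) R
    ≡⟨ cong (_* cellDet (lookup low) R) (invFact-lower L j h k (≤ᵇ≡true⇒≤ h≤ᵇp) (≤ᵇ≡true⇒≤ k≤ᵇq)) ⟩
  invFact low * cellDet (lookup low) R
    ≡⟨ cong (invFact low *_) (cellDet-sortLex low R) ⟩
  invFact low * (sortSign low * cellDet (lookup (sortLex low)) R)
    ≡⟨ solve 3 (λ f s d → f :* (s :* d) := s :* (f :* d)) refl (invFact low) (sortSign low) (cellDet (lookup (sortLex low)) R) ⟩
  sortSign low * (invFact low * cellDet (lookup (sortLex low)) R)
    ≡⟨ cong (λ f → sortSign low * (f * cellDet (lookup (sortLex low)) R)) (invFact-sortLex low) ⟨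
  sortSign low * (invFact (sortLex low) * cellDet (lookup (sortLex low)) R) ∎
  where
  open ≡-Reasoning
  w = ∂-factor h k (lookup L j)
  low = lower L j h k
...   | false = ε-lowering-zero L j h k R
  (trans (cong (∂-factor h k (lookup L j) *_) (cellDet-nondistinct (lower L j h k) lowered-distinct R))
         (ℚP.*-zeroʳ (∂-factor h k (lookup L j))))
ε-lowering L j h k R | false | _ = ε-lowering-zero L j h k R
  (trans (cong (_* cellDet (lookup (lower L j h k)) R) (∂-factor-vanishes h k (lookup L j) λ (h≤p , _) → ≤ᵇ≡false⇒≰ h≤ᵇp h≤p))
         (ℚP.*-zeroˡ (cellDet (lookup (lower L j h k)) R)))
ε-lowering L j h k R | true | false = ε-lowering-zero L j h k R
  (trans (cong (_* cellDet (lookup (lower L j h k)) R) (∂-factor-vanishes h k (lookup L j) λ (_ , k≤q) → ≤ᵇ≡false⇒≰ k≤ᵇq k≤q))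
         (ℚP.*-zeroˡ (cellDet (lookup (lower L j h k)) R)))

coeff-∑∂Δ : ∀ (L : Vec Cell n) h k a b →
  coeff (sumP (λ s → ∂ s h k (Δ L))) a b
    ≡ invFact L * sum (λ s → ∂-factor h k (raise h k (cellsOf a b s))
                             * cellDet (lookup L) (cellsOf a b [ s ↦ raise h k (cellsOf a b s) ]))
coeff-∑∂Δ L h k a b = begin
  coeff (sumP (λ s → ∂ s h k (Δ L))) a b
    ≡⟨ coeff-sumP (λ s → ∂ s h k (Δ L)) a b ⟩
  sum (λ s → coeff (∂ s h k (Δ L)) a b)
    ≡⟨ sum-cong-≗ (λ s → begin
         coeff (∂ s h k (Δ L)) a b
           ≡⟨ coeff-∂ s h k (Δ L) a b ⟩
         w↑ s * coeff (Δ L) (raiseAt a s h) (raiseAt b s k)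
           ≡⟨ cong (w↑ s *_) (coeff-Δ L (raiseAt a s h) (raiseAt b s k)) ⟩
         w↑ s * (invFact L * cellDet (lookup L) (cellsOf (raiseAt a s h) (raiseAt b s k)))
           ≡⟨ cong (λ d → w↑ s * (invFact L * d)) (cellDet-cong {C = lookup L} {lookup L} (λ _ → refl) (cellsOf-raiseAt a b s h k)) ⟩
         w↑ s * (invFact L * D s)
           ≡⟨ solve 3 (λ w f d → w :* (f :* d) := f :* (w :* d)) refl (w↑ s) (invFact L) (D s) ⟩
         invFact L * (w↑ s * D s) ∎) ⟩
  sum (λ s → invFact L * (w↑ s * D s))
    ≡⟨ sum-*ˡ (invFact L) (λ s → w↑ s * D s) ⟩
  invFact L * sum (λ s → w↑ s * D s) ∎
  where
  open ≡-Reasoning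
  w↑ : Fin _ → ℚ
  w↑ s = ∂-factor h k (raise h k (cellsOf a b s))
  D : Fin _ → ℚ
  D s = cellDet (lookup L) (cellsOf a b [ s ↦ raise h k (cellsOf a b s) ])

coeff-∑εΔSet : ∀ (L : Vec Cell n) h k a b →
  coeff (sumP (λ s → scaleP (ε L s h k) (ΔSet (lower L s h k)))) a b
    ≡ invFact L * sum (λ j → ∂-factor h k (lookup L j)
                             * cellDet (lookup L [ j ↦ lowerCell h k (lookup L j) ]) (cellsOf a b))
coeff-∑εΔSet L h k a b = begin
  coeff (sumP (λ s → scaleP (ε L s h k) (ΔSet (lower L s h k)))) a b
    ≡⟨ coeff-sumP (λ s → scaleP (ε L s h k) (ΔSet (lower L s h k))) a b ⟩
  sum (λ j → coeff (scaleP (ε L j h k) (ΔSet (lower L j h k))) a b)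
    ≡⟨ sum-cong-≗ (λ j → begin
         coeff (scaleP (ε L j h k) (ΔSet (lower L j h k))) a b
           ≡⟨ coeff-scaleP (ε L j h k) (ΔSet (lower L j h k)) a b ⟩
         ε L j h k * coeff (Δ (sortLex (lower L j h k))) a b
           ≡⟨ cong (ε L j h k *_) (coeff-Δ (sortLex (lower L j h k)) a b) ⟩
         ε L j h k * (invFact (sortLex (lower L j h k)) * cellDet (lookup (sortLex (lower L j h k))) R)
           ≡⟨ ε-lowering L j h k R ⟨
         invFact L * (w j * cellDet (lookup (lower L j h k)) R)
           ≡⟨ cong (λ d → invFact L * (w j * d)) (cellDet-cong (lookup-[]≔ L j (lowerCell h k (lookup L j))) λ _ → refl) ⟩
         invFact L * (w j * D j) ∎) ⟩
  sum (λ j → invFact L * (w j * D j))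
    ≡⟨ sum-*ˡ (invFact L) (λ j → w j * D j) ⟩
  invFact L * sum (λ j → w j * D j) ∎
  where
  open ≡-Reasoning
  R = cellsOf a b
  w : Fin _ → ℚ
  w j = ∂-factor h k (lookup L j)
  D : Fin _ → ℚ
  D j = cellDet (lookup L [ j ↦ lowerCell h k (lookup L j) ]) R

propositionI1 : ∀ (n : ℕ) (L : Vec Cell n) → LexIncreasing L →
    ∀ (h k : ℕ) → 1 ≤ h + k →
    sumP (λ s → ∂ s h k (Δ L))
      ≈P sumP (λ s → scaleP (ε L s h k) (ΔSet (lower L s h k)))
propositionI1 n L _ h k _ a b = begin
  coeff (sumP (λ s → ∂ s h k (Δ L))) a b
    ≡⟨ coeff-∑∂Δ L h k a b ⟩
  invFact L * sum (λ s → ∂-factor h k (raise h k (R s)) * cellDet (lookup L) (R [ s ↦ raise h k (R s) ]))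
    ≡⟨ cong (invFact L *_) (∑-cellDet-raiseRow≡∑-cellDet-lowerColumn h k (lookup L) R) ⟩
  invFact L * sum (λ j → ∂-factor h k (lookup L j) * cellDet (lookup L [ j ↦ lowerCell h k (lookup L j) ]) R)
    ≡⟨ coeff-∑εΔSet L h k a b ⟨
  coeff (sumP (λ s → scaleP (ε L s h k) (ΔSet (lower L s h k)))) a b ∎
  where
  open ≡-Reasoning
  R = cellsOf a b
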